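{- There exists $\varepsilon_0>0$ such that for every $\varepsilon\in(0,\varepsilon_0)$, setting $c=4.383-\varepsilon$, the following holds. Let $n\ge1$ and let $P$ be the path with vertices $v_0,v_1,\dots,v_n$ and edges $v_iv_{i+1}$ ($0\le i<n$), and let $B=\{v_0,v_n\}$. Fix $j\in\mathbb{Z}$ and let $S'(n)$ be the number of prototypes $(A,f)$ (of $P$ with respect to $B$) satisfying $v_0\notin A$ and $f(v_0)=j$. Then $S'(n)\le 5.02\cdot c^{n-1}$, and at least $0.4\,S'(n)$ of these prototypes satisfy $v_n\notin A$.
   Context: Let $G=(V,E)$ be a graph. For $A\subseteq V$ and $f:A\to\mathbb{Z}$, a bucket extension of $f$ is $\bar f:V\to\mathbb{Z}$ with: (1) $\bar f|_A=f$; (2) $|\bar f(u)-\bar f(v)|\le1$ for every edge $uv$; (3) $\bar f(u)\ge\bar f(v)$ for every edge $uv$ with $u\in A$, $v\notin A$. $(A,f)$ is a partial bucket function if $f$ has a bucket extension. For a fixed $B\subseteq V$, a prototype is a pair $(A,f)$ with $A\subseteq V$ and $f:A\cup B\to\mathbb{Z}$ such that $(A,f|_A)$ is a partial bucket function and there exists a bucket extension $\bar f$ of $f|_A$ with $\bar f|_{A\cup B}=f$. -}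

module Defs where

open import Data.Nat as ℕ using (ℕ; zero; suc)
open import Data.Integer as ℤ using (ℤ; +_)
open import Data.Rational as ℚ using (ℚ)
open import Data.Fin using (Fin; toℕ; fromℕ)
open import Data.Fin.Subset using (Subset; _∈_; _∉_)
open import Data.Fin.Subset.Properties using (_∈?_)
open import Data.Vec using (Vec; lookup)
import Data.Vec
import Data.Bool.Base
import Data.Nat.Base
import Data.Fin
open import Data.Maybe using (Maybe; just; Is-just)
open import Data.List using (List; length; filter)
open import Data.List.Membership.Propositional using () renaming (_∈_ to _∈ₗ_)
open import Data.List.Relation.Unary.Unique.Propositional using (Unique)
open import Data.Product using (Σ; ∃; _×_; _,_; proj₁)
open import Data.Sum using (_⊎_)
open import Function.Bundles using (_⇔_)
open import Relation.Nullary using (¬_)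
open import Relation.Nullary using (¬?)
open import Relation.Binary.PropositionalEquality using (_≡_)

_^ℚ_ : ℚ → ℕ → ℚ
q ^ℚ zero  = ℚ.1ℚ
q ^ℚ suc k = q ℚ.* (q ^ℚ k)

record Graph (m : ℕ) : Set₁ where
  field
    Edge : Fin m → Fin m → Set

open Graph public

-- A partial integer function on Fin m is a vector of Maybe ℤ;
-- its domain is the set of indices carrying 'just'.
PFun : ℕ → Set
PFun m = Vec (Maybe ℤ) m

-- Bucket extension  ḡ : V → ℤ  of the function f restricted to A
-- (condition (1) only uses the values of f on A).
record IsBucketExtension {m : ℕ} (G : Graph m) (A : Subset m)
                         (f : PFun m) (g : Fin m → ℤ) : Set where
  field
    agrees   : ∀ v → v ∈ A → lookup f v ≡ just (g v)
    lipschitz : ∀ u v → Edge G u v → ℤ.∣ g u ℤ.- g v ∣ ℕ.≤ 1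
    outward  : ∀ u v → Edge G u v → u ∈ A → v ∉ A → g v ℤ.≤ g u

IsPartialBucketFunction : ∀ {m} → Graph m → Subset m → PFun m → Set
IsPartialBucketFunction G A f =
  (∀ v → v ∈ A ⇔ Is-just (lookup f v)) ×
  ∃ λ g → IsBucketExtension G A f g

IsPrototype : ∀ {m} → Graph m → (B : Subset m) → Subset m → PFun m → Set
IsPrototype G B A f =
  (∀ v → (v ∈ A ⊎ v ∈ B) ⇔ Is-just (lookup f v)) ×
  ∃ λ g → IsBucketExtension G A f g × (∀ v → v ∈ B → lookup f v ≡ just (g v))

Prototype : ℕ → Set
Prototype m = Subset m × PFun m

PathGraph : (n : ℕ) → Graph (suc n)
PathGraph n = record { Edge = λ u v → toℕ v ≡ suc (toℕ u) ⊎ toℕ u ≡ suc (toℕ v) }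

EndSet : (n : ℕ) → Subset (suc n)
EndSet n = Data.Vec.tabulate (λ i → Data.Bool.Base._∨_ (isZero i) (isLast i))
  where
    open import Data.Bool.Base using (Bool; true; false)
    isZero : Fin (suc n) → Bool
    isZero Fin.zero = true
    isZero (Fin.suc _) = false
    isLast : Fin (suc n) → Bool
    isLast i = Data.Nat.Base._≡ᵇ_ (toℕ i) n

IsS' : (n : ℕ) (j : ℤ) → Prototype (suc n) → Set
IsS' n j (A , f) =
  IsPrototype (PathGraph n) (EndSet n) A f ×
  Fin.zero ∉ A × lookup f Fin.zero ≡ just j

-- L is a duplicate-free enumeration of exactly the elements satisfying P,
-- so length L is the number of such elements.
Enumerates : ∀ {X : Set} → (X → Set) → List X → Set
Enumerates {X} P L = Unique L × (∀ (x : X) → x ∈ₗ L ⇔ P x)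

countVnNotInA : (n : ℕ) → List (Prototype (suc n)) → ℕ
countVnNotInA n L = length (filter (λ p → ¬? (fromℕ n ∈? proj₁ p)) L)

module Submission where

-- A prototype (A , f) counted by S'(n) comes with a bucket extension g with
-- g(v₀) = j.  On the path the bucket conditions say that g moves by
-- admissible steps (Step): by at most one, never up along an edge leaving A
-- and never down along an edge entering A; f records g on A ∪ {vₙ}.  Off A the values of a walk are
-- forgotten, but the values they may still take form an interval; hence the
-- records of walks continuing from an interval are listed recursively by
-- 'suffixes', which is sound, complete and duplicate-free.  Every additive
-- measure of these lists obeys one linear recursion (measure-suffixes); for
-- the length and for the number of records with vₙ ∉ A this gives 'total'
-- and 'lastOut'.  By induction 2 total ≤ 5 lastOut, and total ≤ 5.02 c^(n-1)
-- for every c ≥ 21/5 (GrowthBound); lemma18 takes ε₀ = 0.183, so that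
-- 4.383 - ε ≥ 21/5.

open import Defs
open import Data.Nat using (ℕ; suc; _≤_; _∸_; _*_)
open import Data.Integer using (ℤ; +_)
open import Data.Rational using (ℚ; _/_; _<_; _-_; 0ℚ)
open import Data.Rational as Q using ()
open import Data.List using (List; length)
open import Data.Product using (Σ; ∃; _×_; _,_)

open import Data.Nat using (zero; _+_; z≤n; s≤s; s≤s⁻¹; _≡ᵇ_)
import Data.Nat.Properties as ℕP
import Data.Nat.Coprimality as Coprimality
import Data.Nat.Tactic.RingSolver as ℕ-Solver
import Data.Integer as ℤ
import Data.Integer.Properties as ℤP
open import Data.Integer.Tactic.RingSolver using (solve-∀)
import Data.Rational.Properties as ℚP
import Data.Rational.Unnormalised as ℚᵘ
import Data.Rational.Unnormalised.Properties as ℚᵘP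
open import Data.Rational.Solver using (module +-*-Solver)
open import Data.Product using (proj₁; proj₂)
open import Data.Bool using (Bool; true; false; T)
open import Data.Bool.Properties using (T-≡)
open import Data.Unit using (tt)
open import Data.Empty using (⊥-elim)
open import Data.Sum using (_⊎_; inj₁; inj₂; [_,_]′)
open import Data.Maybe using (Maybe; just; nothing; Is-just)
open import Data.Maybe.Properties using (just-injective)
open import Data.Maybe.Relation.Unary.Any using (just)
open import Data.Fin using (Fin; zero; suc; toℕ; inject₁; fromℕ)
import Data.Fin.Properties as FinP
open import Data.Fin.Subset using (Subset; _∈_; _∉_)
open import Data.Fin.Subset.Properties using (_∈?_)
open import Data.Vec using (Vec; []; _∷_; lookup)
import Data.Vec as Vec
open import Data.Vec.Properties using ([]=⇒lookup; lookup⇒[]=; lookup∘tabulate)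
open import Data.Vec.Functional using () renaming (_∷_ to _∷ᶠ_)
open import Data.List using ([]; _∷_; _++_; map; filter)
open import Data.List.Properties using (length-++; length-map; filter-++)
open import Data.List.Membership.Propositional using () renaming (_∈_ to _∈ₗ_)
open import Data.List.Membership.Propositional.Properties using (∈-++⁺ˡ; ∈-++⁺ʳ; ∈-++⁻; ∈-map⁺; ∈-map⁻)
open import Data.List.Relation.Unary.Any using (here)
open import Data.List.Relation.Unary.All using ([])
open import Data.List.Relation.Unary.AllPairs using ([]; _∷_)
open import Data.List.Relation.Unary.Unique.Propositional using (Unique)
open import Data.List.Relation.Unary.Unique.Propositional.Properties using (++⁺; map⁺)
open import Function using (_∘_)
open import Function.Bundles using (_⇔_; mk⇔; Equivalence)
open import Relation.Nullary using (¬_; Dec; yes; no; does; ¬?)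
open import Relation.Nullary.Decidable using (True; toWitness)
open import Relation.Binary.PropositionalEquality

-- A bucket extension may decrease along an edge unless the edge enters A,
-- and may increase unless it leaves A (a, b: membership of the two ends).
mayDescend : Bool → Bool → Bool
mayDescend false true = false
mayDescend _     _    = true

mayAscend : Bool → Bool → Bool
mayAscend true false = false
mayAscend _    _     = true

data Step (a b : Bool) (x : ℤ) : ℤ → Set where
  stay : Step a b x x
  down : T (mayDescend a b) → Step a b x (ℤ.pred x)
  up   : T (mayAscend a b)  → Step a b x (ℤ.suc x)

step-lipschitz : ∀ {a b x z} → Step a b x z → ℤ.∣ x ℤ.- z ∣ ≤ 1
step-lipschitz {x = x} stay     = ℕP.≤-trans (ℕP.≤-reflexive (cong ℤ.∣_∣ (ℤP.+-inverseʳ x))) z≤n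
step-lipschitz {x = x} (down _) = ℕP.≤-reflexive (cong ℤ.∣_∣ (difference x))
  where
  difference : ∀ x → x ℤ.- (ℤ.-1ℤ ℤ.+ x) ≡ ℤ.1ℤ
  difference = solve-∀
step-lipschitz {x = x} (up _)   = ℕP.≤-reflexive (cong ℤ.∣_∣ (difference x))
  where
  difference : ∀ x → x ℤ.- (ℤ.1ℤ ℤ.+ x) ≡ ℤ.-1ℤ
  difference = solve-∀

step-leaving : ∀ {a b x z} → a ≡ true → b ≡ false → Step a b x z → z ℤ.≤ x
step-leaving refl refl stay        = ℤP.≤-refl
step-leaving refl refl (down _)    = ℤP.i≤j⇒pred[i]≤j ℤP.≤-refl
step-leaving refl refl (up ())

step-entering : ∀ {a b x z} → a ≡ false → b ≡ true → Step a b x z → x ℤ.≤ z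
step-entering refl refl stay        = ℤP.≤-refl
step-entering refl refl (down ())
step-entering {x = x} refl refl (up _) = ℤP.i≤suc[i] x

small : ∀ d → ℤ.∣ d ∣ ≤ 1 → d ≡ ℤ.0ℤ ⊎ d ≡ ℤ.1ℤ ⊎ d ≡ ℤ.-1ℤ
small (+ 0)              _             = inj₁ refl
small (+ 1)              _             = inj₂ (inj₁ refl)
small ℤ.-[1+ 0 ]         _             = inj₂ (inj₂ refl)
small (+ suc (suc _))    (s≤s ())
small ℤ.-[1+ suc _ ]     (s≤s ())

solve-for : ∀ {x z d} → x ℤ.- z ≡ d → z ≡ x ℤ.- d
solve-for {x} {z} refl = recover x z
  where
  recover : ∀ x z → z ≡ x ℤ.- (x ℤ.- z)
  recover = solve-∀

near : ∀ {x z} → ℤ.∣ x ℤ.- z ∣ ≤ 1 → z ≡ x ⊎ z ≡ ℤ.pred x ⊎ z ≡ ℤ.suc x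
near {x} {z} close with small (x ℤ.- z) close
... | inj₁ d≡0         = inj₁ (trans (solve-for {x} d≡0) (ℤP.+-identityʳ x))
... | inj₂ (inj₁ d≡1)  = inj₂ (inj₁ (trans (solve-for {x} d≡1) (ℤP.+-comm x ℤ.-1ℤ)))
... | inj₂ (inj₂ d≡-1) = inj₂ (inj₂ (trans (solve-for {x} d≡-1) (ℤP.+-comm x ℤ.1ℤ)))

step-from-bounds : ∀ a b {x z} → ℤ.∣ x ℤ.- z ∣ ≤ 1 →
                   (a ≡ true → b ≡ false → z ℤ.≤ x) → (a ≡ false → b ≡ true → x ℤ.≤ z) → Step a b x z
step-from-bounds a b {x} {z} close leaving entering with near {x} {z} close
... | inj₁ refl        = stay
... | inj₂ (inj₁ refl) = down (descent-allowed a b entering)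
  where
  descent-allowed : ∀ a b → (a ≡ false → b ≡ true → x ℤ.≤ ℤ.pred x) → T (mayDescend a b)
  descent-allowed false true  x≤pred = ℤP.<-irrefl refl (ℤP.i≤pred[j]⇒i<j (x≤pred refl refl))
  descent-allowed true  _     _      = tt
  descent-allowed false false _      = tt
... | inj₂ (inj₂ refl) = up (ascent-allowed a b leaving)
  where
  ascent-allowed : ∀ a b → (a ≡ true → b ≡ false → ℤ.suc x ℤ.≤ x) → T (mayAscend a b)
  ascent-allowed true  false suc≤x = ℤP.<-irrefl refl (ℤP.suc[i]≤j⇒i<j (suc≤x refl refl))
  ascent-allowed false _     _     = tt
  ascent-allowed true  true  _     = tt

∈⇒true : ∀ {n} {v : Fin n} {A : Subset n} → v ∈ A → lookup A v ≡ true
∈⇒true = []=⇒lookup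

true⇒∈ : ∀ {n} {v : Fin n} {A : Subset n} → lookup A v ≡ true → v ∈ A
true⇒∈ {v = v} {A} = lookup⇒[]= v A

∉⇒false : ∀ {n} {v : Fin n} {A : Subset n} → v ∉ A → lookup A v ≡ false
∉⇒false {v = v} {A} v∉ with lookup A v in v-in
... | true  = ⊥-elim (v∉ (true⇒∈ v-in))
... | false = refl

false⇒∉ : ∀ {n} {v : Fin n} {A : Subset n} → lookup A v ≡ false → v ∉ A
false⇒∉ v-out v∈ with trans (sym (∈⇒true v∈)) v-out
... | ()

forward-edge : ∀ {n} (i : Fin n) → Edge (PathGraph n) (inject₁ i) (suc i)
forward-edge i = inj₁ (cong suc (sym (FinP.toℕ-inject₁ i)))

backward-edge : ∀ {n} (i : Fin n) → Edge (PathGraph n) (suc i) (inject₁ i)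
backward-edge i = inj₂ (cong suc (sym (FinP.toℕ-inject₁ i)))

edge-index : ∀ {n} (u v : Fin (suc n)) → toℕ v ≡ suc (toℕ u) →
             Σ (Fin n) λ i → u ≡ inject₁ i × v ≡ suc i
edge-index u (suc i) v≡ =
  i , FinP.toℕ-injective (trans (sym (ℕP.suc-injective v≡)) (sym (FinP.toℕ-inject₁ i))) , refl

PathSteps : ∀ {n} → Subset (suc n) → (Fin (suc n) → ℤ) → Set
PathSteps {n} A g =
  ∀ (i : Fin n) → Step (lookup A (inject₁ i)) (lookup A (suc i)) (g (inject₁ i)) (g (suc i))

module _ {n} {A : Subset (suc n)} {g : Fin (suc n) → ℤ} where

  bucket⇒steps : (∀ u v → Edge (PathGraph n) u v → ℤ.∣ g u ℤ.- g v ∣ ≤ 1) →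
                 (∀ u v → Edge (PathGraph n) u v → u ∈ A → v ∉ A → g v ℤ.≤ g u) → PathSteps A g
  bucket⇒steps lipschitz outward i =
    step-from-bounds _ _ (lipschitz (inject₁ i) (suc i) (forward-edge i))
      (λ u-in v-out → outward (inject₁ i) (suc i) (forward-edge i) (true⇒∈ u-in) (false⇒∉ v-out))
      (λ u-out v-in → outward (suc i) (inject₁ i) (backward-edge i) (true⇒∈ v-in) (false⇒∉ u-out))

  steps⇒lipschitz : PathSteps A g → ∀ u v → Edge (PathGraph n) u v → ℤ.∣ g u ℤ.- g v ∣ ≤ 1
  steps⇒lipschitz steps u v (inj₁ v≡) with edge-index u v v≡
  ... | i , refl , refl = step-lipschitz (steps i)
  steps⇒lipschitz steps u v (inj₂ u≡) with edge-index v u u≡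
  ... | i , refl , refl =
    subst (_≤ 1) (ℤP.∣i-j∣≡∣j-i∣ (g (inject₁ i)) (g (suc i))) (step-lipschitz (steps i))

  steps⇒outward : PathSteps A g → ∀ u v → Edge (PathGraph n) u v → u ∈ A → v ∉ A → g v ℤ.≤ g u
  steps⇒outward steps u v (inj₁ v≡) u∈ v∉ with edge-index u v v≡
  ... | i , refl , refl = step-leaving (∈⇒true u∈) (∉⇒false v∉) (steps i)
  steps⇒outward steps u v (inj₂ u≡) u∈ v∉ with edge-index v u u≡
  ... | i , refl , refl = step-entering (∉⇒false v∉) (∈⇒true u∈) (steps i)

Records : Bool → Maybe ℤ → ℤ → Set
Records true  y z = y ≡ just z
Records false y z = y ≡ nothing

-- Walk m a x s g: on the m + 1 vertices described by s = (A , F), the values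
-- g continue a vertex of membership a and value x by admissible steps, and F
-- records g exactly on A and on the last vertex.
Walk : (m : ℕ) → Bool → ℤ → Prototype (suc m) → (Fin (suc m) → ℤ) → Set
Walk zero    a x (b ∷ [] , y ∷ []) g = Step a b x (g zero) × y ≡ just (g zero)
Walk (suc m) a x (b ∷ A , y ∷ F) g =
  Step a b x (g zero) × Records b y (g zero) × Walk m b (g zero) (A , F) (g ∘ suc)

RecordedAt : (m : ℕ) → Fin (suc m) → Bool → Maybe ℤ → ℤ → Set
RecordedAt m i b y z = (toℕ i ≡ m → y ≡ just z) × (toℕ i ≢ m → Records b y z)

recorded-present : ∀ {m i b y z} → RecordedAt m i b y z → b ≡ true ⊎ toℕ i ≡ m → y ≡ just z
recorded-present (at-last , _) (inj₂ last) = at-last last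
recorded-present {m} {i} (at-last , inner) (inj₁ refl) with toℕ i ℕP.≟ m
... | yes last    = at-last last
... | no not-last = inner not-last

recorded-absent : ∀ {m i b y z} → RecordedAt m i b y z → b ≡ false → toℕ i ≢ m → y ≡ nothing
recorded-absent (_ , inner) refl not-last = inner not-last

Describes : (m : ℕ) → Subset (suc (suc m)) → Vec (Maybe ℤ) (suc m) → (Fin (suc (suc m)) → ℤ) → Set
Describes m A F g =
  PathSteps A g × (∀ i → RecordedAt m i (lookup A (suc i)) (lookup F i) (g (suc i)))

walk⇒describes : ∀ m a A F g → Walk m a (g zero) (A , F) (g ∘ suc) → Describes m (a ∷ A) F g
walk⇒describes zero a (b ∷ []) (y ∷ []) g (step , y≡) =
  (λ { zero → step }) , (λ { zero → (λ _ → y≡) , (λ not-last → ⊥-elim (not-last refl)) })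
walk⇒describes (suc m) a (b ∷ A) (y ∷ F) g (step , records , walk)
  with walk⇒describes m b A F (g ∘ suc) walk
... | steps , recorded = steps′ , recorded′
  where
  steps′ : PathSteps (a ∷ b ∷ A) g
  steps′ zero    = step
  steps′ (suc i) = steps i
  recorded′ : ∀ i → RecordedAt (suc m) i (lookup (b ∷ A) i) (lookup (y ∷ F) i) (g (suc i))
  recorded′ zero    = (λ ()) , (λ _ → records)
  recorded′ (suc i) = (λ last → proj₁ (recorded i) (ℕP.suc-injective last))
                    , (λ not-last → proj₂ (recorded i) (not-last ∘ cong suc))

describes⇒walk : ∀ m a A F g → Describes m (a ∷ A) F g → Walk m a (g zero) (A , F) (g ∘ suc)
describes⇒walk zero a (b ∷ []) (y ∷ []) g (steps , recorded) =
  steps zero , proj₁ (recorded zero) refl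
describes⇒walk (suc m) a (b ∷ A) (y ∷ F) g (steps , recorded) =
  steps zero , proj₂ (recorded zero) (λ ()) ,
  describes⇒walk m b A F (g ∘ suc) ((steps ∘ suc) , recorded′)
  where
  recorded′ : ∀ i → RecordedAt m i (lookup A i) (lookup F i) (g (suc (suc i)))
  recorded′ i = (λ last → proj₁ (recorded (suc i)) (cong suc last))
              , (λ not-last → proj₂ (recorded (suc i)) (not-last ∘ ℕP.suc-injective))

zero∈EndSet : ∀ n → zero ∈ EndSet n
zero∈EndSet n = lookup⇒[]= zero (EndSet n) refl

last∈EndSet : ∀ m (i : Fin (suc m)) → toℕ i ≡ m → suc i ∈ EndSet (suc m)
last∈EndSet m i last =
  true⇒∈ (trans (lookup∘tabulate (λ k → toℕ k ≡ᵇ m) i)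
                (Equivalence.to T-≡ (ℕP.≡⇒≡ᵇ (toℕ i) m last)))

EndSet⇒last : ∀ m (i : Fin (suc m)) → suc i ∈ EndSet (suc m) → toℕ i ≡ m
EndSet⇒last m i i∈ =
  ℕP.≡ᵇ⇒≡ (toℕ i) m
    (Equivalence.from T-≡ (trans (sym (lookup∘tabulate (λ k → toℕ k ≡ᵇ m) i)) (∈⇒true i∈)))

S'⇒describes : ∀ m j a₀ A y₀ F → IsS' (suc m) j (a₀ ∷ A , y₀ ∷ F) →
               a₀ ≡ false × y₀ ≡ just j ×
               Σ (Fin (suc (suc m)) → ℤ) λ g → g zero ≡ j × Describes m (false ∷ A) F g
S'⇒describes m j true  A y₀ F (_ , v₀∉A , _) = ⊥-elim (v₀∉A (true⇒∈ refl))
S'⇒describes m j false A y₀ F ((domain , g , extension , on-B) , _ , y₀≡) =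
  refl , y₀≡ , g , g₀≡j , bucket⇒steps lipschitz outward , recorded
  where
  open IsBucketExtension extension
  g₀≡j : g zero ≡ j
  g₀≡j = just-injective (trans (sym (on-B zero (zero∈EndSet (suc m)))) y₀≡)
  recorded : ∀ i → RecordedAt m i (lookup A i) (lookup F i) (g (suc i))
  recorded i = (λ last → on-B (suc i) (last∈EndSet m i last)) , inner
    where
    inner : toℕ i ≢ m → Records (lookup A i) (lookup F i) (g (suc i))
    inner not-last with lookup A i in i-in
    ... | true  = agrees (suc i) (true⇒∈ i-in)
    ... | false with lookup F i in entry
    ...   | nothing = refl
    ...   | just _ with Equivalence.from (domain (suc i)) (subst Is-just (sym entry) (just tt))
    ...     | inj₁ i∈A = ⊥-elim (false⇒∉ i-in i∈A)
    ...     | inj₂ i∈B = ⊥-elim (not-last (EndSet⇒last m i i∈B))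

describes⇒S' : ∀ m j A F g → g zero ≡ j → Describes m (false ∷ A) F g →
               IsS' (suc m) j (false ∷ A , just j ∷ F)
describes⇒S' m j A F g g₀≡j (steps , recorded) = (domain , g , extension , on-B) , (λ ()) , refl
  where
  domain : ∀ v → (v ∈ (false ∷ A) ⊎ v ∈ EndSet (suc m)) ⇔ Is-just (lookup (just j ∷ F) v)
  domain zero    = mk⇔ (λ _ → just tt) (λ _ → inj₂ (zero∈EndSet (suc m)))
  domain (suc i) = mk⇔ present recorded-vertex
    where
    present : suc i ∈ (false ∷ A) ⊎ suc i ∈ EndSet (suc m) → Is-just (lookup F i)
    present in-A-or-B = subst Is-just (sym (recorded-present (recorded i) reason)) (just tt)
      where
      reason : lookup A i ≡ true ⊎ toℕ i ≡ m
      reason = [ (λ i∈A → inj₁ (∈⇒true i∈A)) , (λ i∈B → inj₂ (EndSet⇒last m i i∈B)) ]′ in-A-or-B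
    recorded-vertex : Is-just (lookup F i) → suc i ∈ (false ∷ A) ⊎ suc i ∈ EndSet (suc m)
    recorded-vertex is-just with toℕ i ℕP.≟ m
    ... | yes last = inj₂ (last∈EndSet m i last)
    ... | no not-last with lookup A i in i-in
    ...   | true  = inj₁ (true⇒∈ i-in)
    ...   | false =
      ⊥-elim (nothing-is-not-just (subst Is-just (recorded-absent (recorded i) i-in not-last) is-just))
      where
      nothing-is-not-just : ¬ Is-just (nothing {A = ℤ})
      nothing-is-not-just ()
  agrees : ∀ v → v ∈ (false ∷ A) → lookup (just j ∷ F) v ≡ just (g v)
  agrees (suc i) i∈A = recorded-present (recorded i) (inj₁ (∈⇒true i∈A))
  extension : IsBucketExtension (PathGraph (suc m)) (false ∷ A) (just j ∷ F) g
  extension = record { agrees = agrees ; lipschitz = steps⇒lipschitz {A = false ∷ A} {g} steps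
                     ; outward = steps⇒outward {A = false ∷ A} {g} steps }
  on-B : ∀ v → v ∈ EndSet (suc m) → lookup (just j ∷ F) v ≡ just (g v)
  on-B zero    _   = cong just (sym g₀≡j)
  on-B (suc i) i∈B = proj₁ (recorded i) (EndSet⇒last m i i∈B)

-- Off A the value of a walk is not recorded; what matters is the interval of
-- values it may take.  x lies in the integer interval {lo, lo + 1, …, lo + w}:
record Within (lo : ℤ) (w : ℕ) (x : ℤ) : Set where
  constructor offset
  field
    k     : ℕ
    k≤w   : k ≤ w
    x≡lo+k : x ≡ lo ℤ.+ + k

within-lo : ∀ lo {w} → Within lo w lo
within-lo lo = offset 0 z≤n (sym (ℤP.+-identityʳ lo))

within-hi : ∀ lo w → Within lo w (lo ℤ.+ + w)
within-hi lo w = offset w ℕP.≤-refl refl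

within-single : ∀ {lo x} → Within lo 0 x → x ≡ lo
within-single {lo} (offset 0 _ refl) = ℤP.+-identityʳ lo

within-widenʳ : ∀ {lo w x} → Within lo w x → Within lo (suc w) x
within-widenʳ (offset k k≤w x≡) = offset k (ℕP.m≤n⇒m≤1+n k≤w) x≡

within-widenˡ : ∀ {lo w x} → Within lo w x → Within (ℤ.pred lo) (suc w) x
within-widenˡ {lo} (offset k k≤w refl) = offset (suc k) (s≤s k≤w) (shift lo (+ k))
  where
  shift : ∀ lo k → lo ℤ.+ k ≡ (ℤ.-1ℤ ℤ.+ lo) ℤ.+ (ℤ.1ℤ ℤ.+ k)
  shift = solve-∀

within-pred : ∀ {lo w x} → Within lo w x → Within (ℤ.pred lo) w (ℤ.pred x)
within-pred {lo} (offset k k≤w refl) = offset k k≤w (sym (ℤP.pred-+ lo (+ k)))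

within-suc : ∀ {lo w x} → Within lo w x → Within lo (suc w) (ℤ.suc x)
within-suc {lo} (offset k k≤w refl) = offset (suc k) (s≤s k≤w) (shift lo (+ k))
  where
  shift : ∀ lo k → ℤ.1ℤ ℤ.+ (lo ℤ.+ k) ≡ lo ℤ.+ (ℤ.1ℤ ℤ.+ k)
  shift = solve-∀

within-predˡ⁻ : ∀ {lo w z} → Within (ℤ.pred lo) (suc w) z → z ≡ ℤ.pred lo ⊎ Within lo w z
within-predˡ⁻ {lo} (offset 0 _ refl) = inj₁ (ℤP.+-identityʳ (ℤ.pred lo))
within-predˡ⁻ {lo} (offset (suc k) (s≤s k≤w) refl) = inj₂ (offset k k≤w (shift lo (+ k)))
  where
  shift : ∀ lo k → (ℤ.-1ℤ ℤ.+ lo) ℤ.+ (ℤ.1ℤ ℤ.+ k) ≡ lo ℤ.+ k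
  shift = solve-∀

within-sucʳ⁻ : ∀ {lo w z} → Within lo (suc w) z → Within lo w z ⊎ z ≡ ℤ.suc (lo ℤ.+ + w)
within-sucʳ⁻ {lo} {w} (offset k k≤ refl) with ℕP.m≤n⇒m<n∨m≡n k≤
... | inj₁ k<  = inj₁ (offset k (s≤s⁻¹ k<) refl)
... | inj₂ refl = inj₂ (shift lo (+ w))
  where
  shift : ∀ lo k → lo ℤ.+ (ℤ.1ℤ ℤ.+ k) ≡ ℤ.1ℤ ℤ.+ (lo ℤ.+ k)
  shift = solve-∀

-- One admissible step maps the interval {lo, …, lo + w} onto the interval
-- with lower end stepLo a b lo and width stepWidth a b w.
stepLo : Bool → Bool → ℤ → ℤ
stepLo false true lo = lo
stepLo _     _    lo = ℤ.pred lo

stepWidth : Bool → Bool → ℕ → ℕ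
stepWidth true  false w = suc w
stepWidth false true  w = suc w
stepWidth _     _     w = suc (suc w)

step-within : ∀ a b {lo w x z} → Within lo w x → Step a b x z →
              Within (stepLo a b lo) (stepWidth a b w) z
step-within true  true  p stay     = within-widenʳ (within-widenˡ p)
step-within true  true  p (down _) = within-widenʳ (within-widenʳ (within-pred p))
step-within true  true  p (up _)   = within-suc (within-widenˡ p)
step-within false false p stay     = within-widenʳ (within-widenˡ p)
step-within false false p (down _) = within-widenʳ (within-widenʳ (within-pred p))
step-within false false p (up _)   = within-suc (within-widenˡ p)
step-within true  false p stay     = within-widenˡ p
step-within true  false p (down _) = within-widenʳ (within-pred p)
step-within false true  p stay     = within-widenʳ p
step-within false true  p (up _)   = within-suc p

within-step-free : ∀ {a b lo w z} → T (mayDescend a b) → T (mayAscend a b) →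
                   Within (ℤ.pred lo) (suc (suc w)) z → Σ ℤ λ x → Within lo w x × Step a b x z
within-step-free {lo = lo} {w} d u p with within-predˡ⁻ {lo} p
... | inj₁ refl = lo , within-lo lo , down d
... | inj₂ q with within-sucʳ⁻ {lo} q
...   | inj₁ r    = _ , r , stay
...   | inj₂ refl = lo ℤ.+ + w , within-hi lo w , up u

within-step : ∀ a b {lo w z} → Within (stepLo a b lo) (stepWidth a b w) z →
              Σ ℤ λ x → Within lo w x × Step a b x z
within-step true  true  p = within-step-free tt tt p
within-step false false p = within-step-free tt tt p
within-step true  false {lo} p with within-predˡ⁻ {lo} p
... | inj₁ refl = lo , within-lo lo , down tt
... | inj₂ q    = _ , q , stay
within-step false true  {lo} {w} p with within-sucʳ⁻ {lo} p
... | inj₁ q    = _ , q , stay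
... | inj₂ refl = lo ℤ.+ + w , within-hi lo w , up tt

Realisable : (m : ℕ) → Bool → ℤ → ℕ → Prototype (suc m) → Set
Realisable m a lo w s = Σ ℤ λ x → Within lo w x × Σ (Fin (suc m) → ℤ) (Walk m a x s)

blocks : {X : Set} → (ℤ → List X) → ℤ → ℕ → List X
blocks h lo zero    = h lo
blocks h lo (suc k) = h lo ++ blocks h (ℤ.suc lo) k

blocks⁻ : ∀ {X : Set} (h : ℤ → List X) lo k {x} → x ∈ₗ blocks h lo k →
          Σ ℤ λ v → Within lo k v × x ∈ₗ h v
blocks⁻ h lo zero    x∈ = lo , within-lo lo , x∈
blocks⁻ h lo (suc k) x∈ with ∈-++⁻ (h lo) x∈
... | inj₁ x∈h = lo , within-lo lo , x∈h
... | inj₂ x∈b with blocks⁻ h (ℤ.suc lo) k x∈b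
...   | v , offset i i≤k refl , x∈hv = v , offset (suc i) (s≤s i≤k) (shift lo (+ i)) , x∈hv
  where
  shift : ∀ lo i → (ℤ.1ℤ ℤ.+ lo) ℤ.+ i ≡ lo ℤ.+ (ℤ.1ℤ ℤ.+ i)
  shift = solve-∀

blocks⁺ : ∀ {X : Set} (h : ℤ → List X) {lo k v x} → Within lo k v → x ∈ₗ h v → x ∈ₗ blocks h lo k
blocks⁺ h {lo} {zero}  (offset 0 _ refl) x∈ = subst (λ v → _ ∈ₗ h v) (ℤP.+-identityʳ lo) x∈
blocks⁺ h {lo} {suc k} (offset 0 _ refl) x∈ = ∈-++⁺ˡ (subst (λ v → _ ∈ₗ h v) (ℤP.+-identityʳ lo) x∈)
blocks⁺ h {lo} {suc k} (offset (suc i) (s≤s i≤k) refl) x∈ =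
  ∈-++⁺ʳ (h lo) (blocks⁺ h (offset i i≤k (shift lo (+ i))) x∈)
  where
  shift : ∀ lo i → lo ℤ.+ (ℤ.1ℤ ℤ.+ i) ≡ (ℤ.1ℤ ℤ.+ lo) ℤ.+ i
  shift = solve-∀

extend : ∀ {m} → Bool → Maybe ℤ → Prototype (suc m) → Prototype (suc (suc m))
extend b y (A , F) = (b ∷ A , y ∷ F)

final : Bool → ℤ → List (Prototype 1)
final b v = (b ∷ [] , just v ∷ []) ∷ []

-- A vertex in A fixes
-- its value (recorded in F); a vertex outside A only widens the interval.
mutual
  suffixes : (m : ℕ) → Bool → ℤ → ℕ → List (Prototype (suc m))
  suffixes zero    a lo w = blocks (final true)  (stepLo a true lo)  (stepWidth a true w)
                         ++ blocks (final false) (stepLo a false lo) (stepWidth a false w)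
  suffixes (suc m) a lo w = blocks (startingIn m) (stepLo a true lo) (stepWidth a true w)
                         ++ map (extend false nothing) (suffixes m false (stepLo a false lo) (stepWidth a false w))

  startingIn : (m : ℕ) → ℤ → List (Prototype (suc (suc m)))
  startingIn m v = map (extend true (just v)) (suffixes m true v 0)

suffixes-complete : ∀ m a lo w s → Realisable m a lo w s → s ∈ₗ suffixes m a lo w
suffixes-complete zero a lo w (true ∷ [] , _ ∷ []) (x , x∈ , g , st , refl) =
  ∈-++⁺ˡ (blocks⁺ (final true) (step-within a true x∈ st) (here refl))
suffixes-complete zero a lo w (false ∷ [] , _ ∷ []) (x , x∈ , g , st , refl) =
  ∈-++⁺ʳ _ (blocks⁺ (final false) (step-within a false x∈ st) (here refl))
suffixes-complete (suc m) a lo w (true ∷ A , _ ∷ F) (x , x∈ , g , st , refl , walk) =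
  ∈-++⁺ˡ (blocks⁺ (startingIn m) (step-within a true x∈ st)
    (∈-map⁺ _ (suffixes-complete m true (g zero) 0 (A , F) (g zero , within-lo _ , g ∘ suc , walk))))
suffixes-complete (suc m) a lo w (false ∷ A , _ ∷ F) (x , x∈ , g , st , refl , walk) =
  ∈-++⁺ʳ _ (∈-map⁺ _ (suffixes-complete m false _ _ (A , F) (g zero , step-within a false x∈ st , g ∘ suc , walk)))

suffixes-sound : ∀ m a lo w s → s ∈ₗ suffixes m a lo w → Realisable m a lo w s
suffixes-sound zero a lo w s s∈ with ∈-++⁻ (blocks (final true) (stepLo a true lo) (stepWidth a true w)) s∈
... | inj₁ s∈₁ with blocks⁻ (final true) (stepLo a true lo) (stepWidth a true w) s∈₁
...   | v , v∈ , here refl with within-step a true v∈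
...     | x , x∈ , st = x , x∈ , (λ _ → v) , st , refl
suffixes-sound zero a lo w s s∈ | inj₂ s∈₂ with blocks⁻ (final false) (stepLo a false lo) (stepWidth a false w) s∈₂
...   | v , v∈ , here refl with within-step a false v∈
...     | x , x∈ , st = x , x∈ , (λ _ → v) , st , refl
suffixes-sound (suc m) a lo w s s∈ with ∈-++⁻ (blocks (startingIn m) (stepLo a true lo) (stepWidth a true w)) s∈
... | inj₁ s∈₁ with blocks⁻ (startingIn m) (stepLo a true lo) (stepWidth a true w) s∈₁
...   | v , v∈ , s∈v with ∈-map⁻ (extend true (just v)) s∈v
...     | s′ , s′∈ , refl with suffixes-sound m true v 0 s′ s′∈ | within-step a true v∈
...       | x′ , x′∈ , g , walk | x , x∈ , st =
            x , x∈ , v ∷ᶠ g , st , refl , subst (λ t → Walk m true t s′ g) (within-single x′∈) walk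
suffixes-sound (suc m) a lo w s s∈ | inj₂ s∈₂ with ∈-map⁻ (extend false nothing) s∈₂
...   | s′ , s′∈ , refl with suffixes-sound m false _ _ s′ s′∈
...     | x′ , x′∈ , g , walk with within-step a false x′∈
...       | x , x∈ , st = x , x∈ , x′ ∷ᶠ g , st , refl , walk

within-above : ∀ {lo k v} → Within (ℤ.suc lo) k v → lo ≢ v
within-above {lo} (offset i _ refl) =
  ℤP.<⇒≢ (ℤP.suc[i]≤j⇒i<j (ℤP.i≤i+j (ℤ.suc lo) (+ i)))

blocks-unique : ∀ {X : Set} (tag : X → Maybe ℤ) (h : ℤ → List X) →
                (∀ v → Unique (h v)) → (∀ {v x} → x ∈ₗ h v → tag x ≡ just v) →
                ∀ lo k → Unique (blocks h lo k)
blocks-unique tag h unique-h tagged lo zero    = unique-h lo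
blocks-unique tag h unique-h tagged lo (suc k) =
  ++⁺ (unique-h lo) (blocks-unique tag h unique-h tagged (ℤ.suc lo) k) separated
  where
  separated : ∀ {x} → ¬ (x ∈ₗ h lo × x ∈ₗ blocks h (ℤ.suc lo) k)
  separated (x∈₁ , x∈₂) with blocks⁻ h (ℤ.suc lo) k x∈₂
  ... | v , v∈ , x∈hv = within-above v∈ (just-injective (trans (sym (tagged x∈₁)) (tagged x∈hv)))

++-unique-split : ∀ {X : Set} (tag : X → Bool) {xs ys : List X} → Unique xs → Unique ys →
                  (∀ {x} → x ∈ₗ xs → tag x ≡ true) → (∀ {y} → y ∈ₗ ys → tag y ≡ false) →
                  Unique (xs ++ ys)
++-unique-split tag unique-xs unique-ys tag-xs tag-ys =
  ++⁺ unique-xs unique-ys λ (x∈xs , x∈ys) → true≢false (trans (sym (tag-xs x∈xs)) (tag-ys x∈ys))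
  where
  true≢false : true ≢ false
  true≢false ()

firstIn : ∀ {m} → Prototype (suc m) → Bool
firstIn (A , F) = Vec.head A

firstEntry : ∀ {m} → Prototype (suc m) → Maybe ℤ
firstEntry (A , F) = Vec.head F

extend-injective : ∀ {m} b y {s t : Prototype (suc m)} → extend b y s ≡ extend b y t → s ≡ t
extend-injective b y refl = refl

extend-first : ∀ {m b y} {xs : List (Prototype (suc m))} {s} → s ∈ₗ map (extend b y) xs →
               firstIn s ≡ b × firstEntry s ≡ y
extend-first {b = b} {y} s∈ with ∈-map⁻ (extend b y) s∈
... | _ , _ , refl = refl , refl

final-unique : ∀ b lo k → Unique (blocks (final b) lo k)
final-unique b = blocks-unique firstEntry (final b) (λ _ → [] ∷ []) λ { (here refl) → refl }

final-first : ∀ b {lo k s} → s ∈ₗ blocks (final b) lo k → firstIn s ≡ b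
final-first b {lo} {k} s∈ with blocks⁻ (final b) lo k s∈
... | _ , _ , here refl = refl

startingIn-first : ∀ m {lo k s} → s ∈ₗ blocks (startingIn m) lo k → firstIn s ≡ true
startingIn-first m {lo} {k} s∈ with blocks⁻ (startingIn m) lo k s∈
... | _ , _ , s∈v = proj₁ (extend-first s∈v)

suffixes-unique : ∀ m a lo w → Unique (suffixes m a lo w)
suffixes-unique zero a lo w =
  ++-unique-split firstIn (final-unique true lo₁ w₁) (final-unique false lo₀ w₀)
    (final-first true {lo₁} {w₁}) (final-first false {lo₀} {w₀})
  where
  lo₁ lo₀ : ℤ
  lo₁ = stepLo a true lo
  lo₀ = stepLo a false lo
  w₁ w₀ : ℕ
  w₁ = stepWidth a true w
  w₀ = stepWidth a false w
suffixes-unique (suc m) a lo w =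
  ++-unique-split firstIn
    (blocks-unique firstEntry (startingIn m) unique-startingIn (proj₂ ∘ extend-first) lo₁ w₁)
    (map⁺ (extend-injective false nothing) (suffixes-unique m false lo₀ w₀))
    (startingIn-first m {lo₁} {w₁})
    (proj₁ ∘ extend-first)
  where
  lo₁ lo₀ : ℤ
  lo₁ = stepLo a true lo
  lo₀ = stepLo a false lo
  w₁ w₀ : ℕ
  w₁ = stepWidth a true w
  w₀ = stepWidth a false w
  unique-startingIn : ∀ v → Unique (startingIn m v)
  unique-startingIn v = map⁺ (extend-injective true (just v)) (suffixes-unique m true v 0)

-- Counting suffixes with weight c₁ or c₀ according to whether the last vertex
-- lies in A.  The count depends only on the width of the interval; all
-- suffixes (total) and those ending outside A (lastOut) are instances.
weighted : ℕ → ℕ → ℕ → Bool → ℕ → ℕ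
weighted c₁ c₀ zero    a w = suc (stepWidth a true w) * c₁ + suc (stepWidth a false w) * c₀
weighted c₁ c₀ (suc m) a w =
  suc (stepWidth a true w) * weighted c₁ c₀ m true 0 + weighted c₁ c₀ m false (stepWidth a false w)

total lastOut : ℕ → Bool → ℕ → ℕ
total   = weighted 1 1
lastOut = weighted 0 1

blocks-measure : ∀ {X : Set} (μ : List X → ℕ) → (∀ xs ys → μ (xs ++ ys) ≡ μ xs + μ ys) →
                 (h : ℤ → List X) {c : ℕ} → (∀ v → μ (h v) ≡ c) →
                 ∀ lo k → μ (blocks h lo k) ≡ suc k * c
blocks-measure μ additive h {c} μh lo zero    = trans (μh lo) (sym (ℕP.+-identityʳ c))
blocks-measure μ additive h {c} μh lo (suc k) =
  trans (additive (h lo) _) (cong₂ _+_ (μh lo) (blocks-measure μ additive h μh (ℤ.suc lo) k))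

module _ (μ : ∀ m → List (Prototype (suc m)) → ℕ)
         (additive : ∀ m xs ys → μ m (xs ++ ys) ≡ μ m xs + μ m ys)
         (extend-invariant : ∀ m b y xs → μ (suc m) (map (extend b y) xs) ≡ μ m xs)
         {c₁ c₀ : ℕ} (final-in : ∀ v → μ 0 (final true v) ≡ c₁) (final-out : ∀ v → μ 0 (final false v) ≡ c₀)
         where

  measure-suffixes : ∀ m a lo w → μ m (suffixes m a lo w) ≡ weighted c₁ c₀ m a w
  measure-suffixes zero a lo w =
    trans (additive 0 (blocks (final true) lo₁ w₁) (blocks (final false) lo₀ w₀))
      (cong₂ _+_ (blocks-measure (μ 0) (additive 0) (final true) final-in lo₁ w₁)
                 (blocks-measure (μ 0) (additive 0) (final false) final-out lo₀ w₀))
    where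
    lo₁ lo₀ : ℤ
    lo₁ = stepLo a true lo
    lo₀ = stepLo a false lo
    w₁ w₀ : ℕ
    w₁ = stepWidth a true w
    w₀ = stepWidth a false w
  measure-suffixes (suc m) a lo w =
    trans (additive (suc m) (blocks (startingIn m) lo₁ w₁) (map (extend false nothing) (suffixes m false lo₀ w₀)))
      (cong₂ _+_ (blocks-measure (μ (suc m)) (additive (suc m)) (startingIn m) measure-startingIn lo₁ w₁)
                 (trans (extend-invariant m false nothing (suffixes m false lo₀ w₀))
                        (measure-suffixes m false lo₀ w₀)))
    where
    lo₁ lo₀ : ℤ
    lo₁ = stepLo a true lo
    lo₀ = stepLo a false lo
    w₁ w₀ : ℕ
    w₁ = stepWidth a true w
    w₀ = stepWidth a false w
    measure-startingIn : ∀ v → μ (suc m) (startingIn m v) ≡ weighted c₁ c₀ m true 0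
    measure-startingIn v =
      trans (extend-invariant m true (just v) (suffixes m true v 0)) (measure-suffixes m true v 0)

countOut-additive : ∀ m (xs ys : List (Prototype (suc m))) →
                    countVnNotInA m (xs ++ ys) ≡ countVnNotInA m xs + countVnNotInA m ys
countOut-additive m xs ys = trans (cong length (filter-++ out? xs ys)) (length-++ (filter out? xs))
  where
  out? : (p : Prototype (suc m)) → Dec (fromℕ m ∉ proj₁ p)
  out? p = ¬? (fromℕ m ∈? proj₁ p)

countOut-extend : ∀ m b y (xs : List (Prototype (suc m))) →
                  countVnNotInA (suc m) (map (extend b y) xs) ≡ countVnNotInA m xs
countOut-extend m b y []             = refl
countOut-extend m b y ((A , F) ∷ xs) with does (¬? (fromℕ m ∈? A))
... | true  = cong suc (countOut-extend m b y xs)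
... | false = countOut-extend m b y xs

length-suffixes : ∀ m a lo w → length (suffixes m a lo w) ≡ total m a w
length-suffixes = measure-suffixes (λ _ → length) (λ _ xs _ → length-++ xs) (λ _ _ _ xs → length-map _ xs)
                    (λ _ → refl) (λ _ → refl)

countOut-suffixes : ∀ m a lo w → countVnNotInA m (suffixes m a lo w) ≡ lastOut m a w
countOut-suffixes = measure-suffixes countVnNotInA countOut-additive countOut-extend (λ _ → refl) (λ _ → refl)

ratio-combine : ∀ s t t′ u u′ → 2 * t ≤ 5 * t′ → 2 * u ≤ 5 * u′ → 2 * (s * t + u) ≤ 5 * (s * t′ + u′)
ratio-combine s t t′ u u′ t-ratio u-ratio = begin
  2 * (s * t + u)         ≡⟨ distribute 2 s t u ⟩
  s * (2 * t) + 2 * u     ≤⟨ ℕP.+-mono-≤ (ℕP.*-monoʳ-≤ s t-ratio) u-ratio ⟩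
  s * (5 * t′) + 5 * u′   ≡⟨ distribute 5 s t′ u′ ⟨
  5 * (s * t′ + u′)       ∎
  where
  open ℕP.≤-Reasoning
  distribute : ∀ c s t u → c * (s * t + u) ≡ s * (c * t) + c * u
  distribute = ℕ-Solver.solve-∀

lastOut-ratio : ∀ m a w → 2 * total m a w ≤ 5 * lastOut m a w
lastOut-ratio zero true w = begin
  2 * ((3 + w) * 1 + (2 + w) * 1)   ≡⟨ expand w ⟩
  10 + 4 * w                        ≤⟨ ℕP.+-monoʳ-≤ 10 (ℕP.*-monoˡ-≤ w (ℕP.n≤1+n 4)) ⟩
  10 + 5 * w                        ≡⟨ collect w ⟩
  5 * ((3 + w) * 0 + (2 + w) * 1)   ∎
  where
  open ℕP.≤-Reasoning
  expand : ∀ w → 2 * ((3 + w) * 1 + (2 + w) * 1) ≡ 10 + 4 * w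
  expand = ℕ-Solver.solve-∀
  collect : ∀ w → 10 + 5 * w ≡ 5 * ((3 + w) * 0 + (2 + w) * 1)
  collect = ℕ-Solver.solve-∀
lastOut-ratio zero false w = begin
  2 * ((2 + w) * 1 + (3 + w) * 1)   ≡⟨ expand w ⟩
  10 + 4 * w                        ≤⟨ ℕP.+-mono-≤ (ℕP.m≤m+n 10 5) (ℕP.*-monoˡ-≤ w (ℕP.n≤1+n 4)) ⟩
  15 + 5 * w                        ≡⟨ collect w ⟩
  5 * ((2 + w) * 0 + (3 + w) * 1)   ∎
  where
  open ℕP.≤-Reasoning
  expand : ∀ w → 2 * ((2 + w) * 1 + (3 + w) * 1) ≡ 10 + 4 * w
  expand = ℕ-Solver.solve-∀
  collect : ∀ w → 15 + 5 * w ≡ 5 * ((2 + w) * 0 + (3 + w) * 1)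
  collect = ℕ-Solver.solve-∀
lastOut-ratio (suc m) a w =
  ratio-combine (suc (stepWidth a true w)) (total m true 0) (lastOut m true 0)
                (total m false w₀) (lastOut m false w₀)
                (lastOut-ratio m true 0) (lastOut-ratio m false w₀)
  where
  w₀ : ℕ
  w₀ = stepWidth a false w

ι : ℕ → ℚ
ι n = + n / 1

normal : ℕ → ℚ
normal n = Q.mkℚ (+ n) 0 (Coprimality.sym (Coprimality.1-coprimeTo n))

ι≡normal : ∀ n → ι n ≡ normal n
ι≡normal n = ℚP.↥p/↧p≡p (normal n)

ι-+ : ∀ m n → ι (m + n) ≡ ι m Q.+ ι n
ι-+ m n rewrite ι≡normal (m + n) | ι≡normal m | ι≡normal n =
  ℚP.toℚᵘ-injective (ℚᵘP.≃-trans (ℚᵘ.*≡* (identity (+ m) (+ n)))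
                                  (ℚᵘP.≃-sym (ℚP.toℚᵘ-homo-+ (normal m) (normal n))))
  where
  identity : ∀ (i j : ℤ) → (i ℤ.+ j) ℤ.* ℤ.1ℤ ≡ (i ℤ.* ℤ.1ℤ ℤ.+ j ℤ.* ℤ.1ℤ) ℤ.* ℤ.1ℤ
  identity = solve-∀

ι-* : ∀ m n → ι (m * n) ≡ ι m Q.* ι n
ι-* m n rewrite ι≡normal (m * n) | ι≡normal m | ι≡normal n =
  ℚP.toℚᵘ-injective (ℚᵘP.≃-trans (ℚᵘ.*≡* (cong (ℤ._* ℤ.1ℤ) (ℤP.pos-* m n)))
                                  (ℚᵘP.≃-sym (ℚP.toℚᵘ-homo-* (normal m) (normal n))))

ι-nonNeg : ∀ n → 0ℚ Q.≤ ι n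
ι-nonNeg n rewrite ι≡normal n = ℚP.nonNegative⁻¹ (normal n)

by-computation : ∀ p q → {True (p ℚP.≤? q)} → p Q.≤ q
by-computation p q {p≤q} = toWitness p≤q

nonNeg-+ : ∀ {p q} → 0ℚ Q.≤ p → 0ℚ Q.≤ q → 0ℚ Q.≤ p Q.+ q
nonNeg-+ p≥0 q≥0 = ℚP.≤-trans (by-computation 0ℚ (0ℚ Q.+ 0ℚ)) (ℚP.+-mono-≤ p≥0 q≥0)

nonNeg-* : ∀ {p q} → 0ℚ Q.≤ p → 0ℚ Q.≤ q → 0ℚ Q.≤ p Q.* q
nonNeg-* {p} {q} p≥0 q≥0 =
  ℚP.nonNegative⁻¹ (p Q.* q) {{ℚP.nonNeg*nonNeg⇒nonNeg p {{Q.nonNegative p≥0}} q {{Q.nonNegative q≥0}}}}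

scaleˡ : ∀ {r p q} → 0ℚ Q.≤ r → p Q.≤ q → r Q.* p Q.≤ r Q.* q
scaleˡ {r} r≥0 = ℚP.*-monoˡ-≤-nonNeg r {{Q.nonNegative r≥0}}

scaleʳ : ∀ {r p q} → 0ℚ Q.≤ r → p Q.≤ q → p Q.* r Q.≤ q Q.* r
scaleʳ {r} r≥0 = ℚP.*-monoʳ-≤-nonNeg r {{Q.nonNegative r≥0}}

ι-linear : ∀ s t u → ι (s * t + u) ≡ ι s Q.* ι t Q.+ ι u
ι-linear s t u = trans (ι-+ (s * t) u) (cong (Q._+ ι u) (ι-* s t))

module GrowthBound (c : ℚ) (c≥21/5 : + 21 / 5 Q.≤ c) where

  open ℚP.≤-Reasoning
  open +-*-Solver

  power-nonNeg : ∀ m → 0ℚ Q.≤ c ^ℚ m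
  power-nonNeg zero    = by-computation 0ℚ Q.1ℚ
  power-nonNeg (suc m) = nonNeg-* (ℚP.≤-trans (by-computation 0ℚ (+ 21 / 5)) c≥21/5) (power-nonNeg m)

  coeff : ℕ → ℚ
  coeff w = + 502 / 100 Q.+ ι 2 Q.* ι w

  coeff-nonNeg : ∀ w → 0ℚ Q.≤ coeff w
  coeff-nonNeg w = nonNeg-+ (by-computation 0ℚ (+ 502 / 100)) (nonNeg-* (ι-nonNeg 2) (ι-nonNeg w))

  InsideBound : ℕ → Set
  InsideBound m = ι (total m true 0) Q.≤ ι 6 Q.* (c ^ℚ m)

  OutsideBound : ℕ → Set
  OutsideBound m = ∀ w → ι (total m false w) Q.≤ coeff w Q.* (c ^ℚ m)

  outside-base : OutsideBound 0
  outside-base w = begin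
    ι ((2 + w) * 1 + (3 + w) * 1)  ≡⟨ cong ι (collect w) ⟩
    ι (5 + 2 * w)                  ≡⟨ trans (ι-+ 5 (2 * w)) (cong (ι 5 Q.+_) (ι-* 2 w)) ⟩
    ι 5 Q.+ ι 2 Q.* ι w            ≤⟨ ℚP.+-monoˡ-≤ (ι 2 Q.* ι w) (by-computation (ι 5) (+ 502 / 100)) ⟩
    coeff w                        ≡⟨ ℚP.*-identityʳ (coeff w) ⟨
    coeff w Q.* Q.1ℚ               ∎
    where
    collect : ∀ w → (2 + w) * 1 + (3 + w) * 1 ≡ 5 + 2 * w
    collect = ℕ-Solver.solve-∀

  inside-step : ∀ m → InsideBound m → OutsideBound m → InsideBound (suc m)
  inside-step m inside outside = begin
    ι (3 * t + u)                          ≡⟨ ι-linear 3 t u ⟩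
    ι 3 Q.* ι t Q.+ ι u                    ≤⟨ ℚP.+-mono-≤ (scaleˡ (ι-nonNeg 3) inside) (outside 1) ⟩
    ι 3 Q.* (ι 6 Q.* C) Q.+ coeff 1 Q.* C  ≡⟨ solve 1 (λ X → con (ι 3) :* (con (ι 6) :* X) :+ con (coeff 1) :* X
                                                          := con (+ 2502 / 100) :* X) refl C ⟩
    + 2502 / 100 Q.* C                     ≤⟨ scaleʳ (power-nonNeg m) growth ⟩
    ι 6 Q.* c Q.* C                        ≡⟨ ℚP.*-assoc (ι 6) c C ⟩
    ι 6 Q.* (c Q.* C)                      ∎
    where
    t u : ℕ
    t = total m true 0
    u = total m false 1
    C : ℚ
    C = c ^ℚ m
    growth : + 2502 / 100 Q.≤ ι 6 Q.* c
    growth = ℚP.≤-trans (by-computation (+ 2502 / 100) (ι 6 Q.* (+ 21 / 5))) (scaleˡ (ι-nonNeg 6) c≥21/5)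

  outside-step : ∀ m → InsideBound m → OutsideBound m → OutsideBound (suc m)
  outside-step m inside outside w = begin
    ι ((2 + w) * t + u)                                       ≡⟨ ι-linear (2 + w) t u ⟩
    ι (2 + w) Q.* ι t Q.+ ι u                                 ≤⟨ ℚP.+-mono-≤ (scaleˡ (ι-nonNeg (2 + w)) inside)
                                                                              (outside (2 + w)) ⟩
    ι (2 + w) Q.* (ι 6 Q.* C) Q.+ coeff (2 + w) Q.* C         ≡⟨ cong (λ y → y Q.* (ι 6 Q.* C) Q.+ (κ Q.+ ι 2 Q.* y) Q.* C)
                                                                      (ι-+ 2 w) ⟩
    (ι 2 Q.+ x) Q.* (ι 6 Q.* C) Q.+ (κ Q.+ ι 2 Q.* (ι 2 Q.+ x)) Q.* C
      ≡⟨ solve 2 (λ x X → (con (ι 2) :+ x) :* (con (ι 6) :* X) :+ (con κ :+ con (ι 2) :* (con (ι 2) :+ x)) :* X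
                          := (con (+ 2102 / 100) :+ con (ι 8) :* x) :* X) refl x C ⟩
    (+ 2102 / 100 Q.+ ι 8 Q.* x) Q.* C                        ≤⟨ scaleʳ (power-nonNeg m) growth ⟩
    coeff w Q.* c Q.* C                                       ≡⟨ ℚP.*-assoc (coeff w) c C ⟩
    coeff w Q.* (c Q.* C)                                     ∎
    where
    t u : ℕ
    t = total m true 0
    u = total m false (2 + w)
    C x κ r : ℚ
    C = c ^ℚ m
    x = ι w
    κ = + 502 / 100
    r = + 21 / 5
    growth : + 2102 / 100 Q.+ ι 8 Q.* x Q.≤ coeff w Q.* c
    growth = begin
      + 2102 / 100 Q.+ ι 8 Q.* x    ≤⟨ ℚP.+-mono-≤ (by-computation (+ 2102 / 100) (κ Q.* r))
                                                   (scaleʳ (ι-nonNeg w) (by-computation (ι 8) (ι 2 Q.* r))) ⟩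
      κ Q.* r Q.+ ι 2 Q.* r Q.* x   ≡⟨ solve 2 (λ x d → con κ :* d :+ con (ι 2) :* d :* x
                                                     := (con κ :+ con (ι 2) :* x) :* d) refl x r ⟩
      coeff w Q.* r                 ≤⟨ scaleˡ (coeff-nonNeg w) c≥21/5 ⟩
      coeff w Q.* c                 ∎

  bounds : ∀ m → InsideBound m × OutsideBound m
  bounds zero    = by-computation (ι (total 0 true 0)) (ι 6 Q.* Q.1ℚ) , outside-base
  bounds (suc m) = inside-step m inside outside , outside-step m inside outside
    where
    inside : InsideBound m
    inside = proj₁ (bounds m)
    outside : OutsideBound m
    outside = proj₂ (bounds m)

S'-list : (m : ℕ) → ℤ → List (Prototype (suc (suc m)))
S'-list m j = map (extend false (just j)) (suffixes m false j 0)

S'-list-complete : ∀ m j p → p ∈ₗ S'-list m j ⇔ IsS' (suc m) j p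
S'-list-complete m j (a₀ ∷ A , y₀ ∷ F) = mk⇔ listed⇒S' S'⇒listed
  where
  listed⇒S' : (a₀ ∷ A , y₀ ∷ F) ∈ₗ S'-list m j → IsS' (suc m) j (a₀ ∷ A , y₀ ∷ F)
  listed⇒S' p∈ with ∈-map⁻ (extend false (just j)) p∈
  ... | s , s∈ , refl with suffixes-sound m false j 0 s s∈
  ...   | x , x∈ , g , walk =
          describes⇒S' m j A F (x ∷ᶠ g) (within-single x∈)
            (walk⇒describes m false A F (x ∷ᶠ g) walk)
  S'⇒listed : IsS' (suc m) j (a₀ ∷ A , y₀ ∷ F) → (a₀ ∷ A , y₀ ∷ F) ∈ₗ S'-list m j
  S'⇒listed counted with S'⇒describes m j a₀ A y₀ F counted
  ... | refl , refl , g , g₀≡j , description =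
        ∈-map⁺ (extend false (just j)) (suffixes-complete m false j 0 (A , F)
          (g zero , subst (Within j 0) (sym g₀≡j) (within-lo j) , g ∘ suc ,
           describes⇒walk m false A F g description))

S'-list-enumerates : ∀ m j → Enumerates (IsS' (suc m) j) (S'-list m j)
S'-list-enumerates m j =
  map⁺ (extend-injective false (just j)) (suffixes-unique m false j 0) , S'-list-complete m j

length-S'-list : ∀ m j → length (S'-list m j) ≡ total m false 0
length-S'-list m j = trans (length-map _ (suffixes m false j 0)) (length-suffixes m false j 0)

countOut-S'-list : ∀ m j → countVnNotInA (suc m) (S'-list m j) ≡ lastOut m false 0
countOut-S'-list m j =
  trans (countOut-extend m false (just j) (suffixes m false j 0)) (countOut-suffixes m false j 0)

S'-bounds : ∀ (c : ℚ) → + 21 / 5 Q.≤ c → ∀ m j →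
  ∃ λ (L : List (Prototype (suc (suc m)))) →
    Enumerates (IsS' (suc m) j) L ×
    ((+ length L) / 1 Q.≤ ((+ 502) / 100) Q.* (c ^ℚ m)) ×
    (4 * length L ≤ 10 * countVnNotInA (suc m) L)
S'-bounds c c≥21/5 m j = S'-list m j , S'-list-enumerates m j , size , proportion
  where
  size : ι (length (S'-list m j)) Q.≤ (+ 502 / 100) Q.* (c ^ℚ m)
  size rewrite length-S'-list m j = proj₂ (GrowthBound.bounds c c≥21/5 m) 0
  proportion : 4 * length (S'-list m j) ≤ 10 * countVnNotInA (suc m) (S'-list m j)
  proportion rewrite length-S'-list m j | countOut-S'-list m j =
    subst₂ _≤_ (sym (ℕP.*-assoc 2 2 (total m false 0))) (sym (ℕP.*-assoc 2 5 (lastOut m false 0)))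
      (ℕP.*-monoʳ-≤ 2 (lastOut-ratio m false 0))

lemma18 : Σ ℚ λ ε₀ → 0ℚ < ε₀ ×
    (∀ (ε : ℚ) → 0ℚ < ε → ε < ε₀ →
    ∀ (n : ℕ) → 1 ≤ n → ∀ (j : ℤ) →
    ∃ λ (L : List (Prototype (suc n))) →
    Enumerates (IsS' n j) L ×
    ((+ length L) / 1 Q.≤ ((+ 502) / 100) Q.* ((((+ 4383) / 1000) - ε) ^ℚ (n ∸ 1))) ×
    (4 * length L ≤ 10 * countVnNotInA n L))
lemma18 = ε₀ , ε₀-positive , λ where
    ε _ ε<ε₀ zero    ()
    ε _ ε<ε₀ (suc m) _  j → S'-bounds (+ 4383 / 1000 - ε) (rate ε ε<ε₀) m j
  where
  -- chosen so that 4.383 - ε₀ = 21/5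
  ε₀ : ℚ
  ε₀ = + 183 / 1000
  ε₀-positive : 0ℚ < ε₀
  ε₀-positive = toWitness {a? = 0ℚ ℚP.<? ε₀} _
  rate : ∀ ε → ε < ε₀ → + 21 / 5 Q.≤ + 4383 / 1000 - ε
  rate ε ε<ε₀ = ℚP.≤-trans (by-computation (+ 21 / 5) (+ 4383 / 1000 - ε₀))
                           (ℚP.+-monoʳ-≤ (+ 4383 / 1000) (ℚP.neg-antimono-≤ (ℚP.<⇒≤ ε<ε₀)))
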